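{- Let $p,q$ be distinct primes greater than $5$, let $\mathbb{Z}_{pq} = \langle x_p\rangle \times \langle x_q\rangle$ with $|x_p| = p$, $|x_q| = q$, and let $G = (\mathbb{Z}_2)^3 \ltimes \mathbb{Z}_{pq}$. Suppose $S = \{e_1 x_q,\ e_2,\ e_3,\ e_1e_2x_p\}$, where $\langle e_1,e_2,e_3\rangle = (\mathbb{Z}_2)^3$, such that $e_1$ inverts $\langle x_p\rangle$ and $\langle x_q\rangle$, and $e_2$ and $e_3$ centralize $\langle x_p\rangle$ and invert $\langle x_q\rangle$. Then $\mathrm{Cay}(G;S)$ has a hamiltonian cycle.
   Context: $\mathrm{Cay}(G;S)$ is the graph with vertex set $G$ in which $g,h$ are adjacent iff $h = gs$ for some $s\in S\cup S^{ -1}$. An element inverts a subgroup if conjugation by it sends every element of the subgroup to its inverse. -}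

module Defs where

open import Data.Nat using (ℕ; NonZero; _≤_; _∸_)
open import Data.Nat.DivMod using (_mod_)
open import Data.Bool using (Bool; true; false; _xor_; if_then_else_)
open import Data.Fin using (Fin; toℕ)
open import Data.List using (List; []; _∷_; _++_; [_]; length)
open import Data.List.Membership.Propositional using (_∈_)
open import Data.List.Relation.Unary.Unique.Propositional using (Unique)
open import Data.List.Relation.Unary.Linked using (Linked)
open import Data.Product using (Σ; ∃; _×_; _,_)
open import Data.Sum using (_⊎_)
open import Relation.Binary.PropositionalEquality using (_≡_)
import Data.Nat as N

module _ {n : ℕ} {{_ : NonZero n}} where
  _+ₙ_ : Fin n → Fin n → Fin n
  x +ₙ y = (toℕ x N.+ toℕ y) mod n

  -ₙ_ : Fin n → Fin n
  -ₙ x = (n ∸ toℕ x) mod n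

  act : Bool → Fin n → Fin n
  act b x = if b then -ₙ x else x

-- Element e₁^a e₂^b e₃^c x_p^i x_q^j of G = (ℤ₂)³ ⋉ (⟨x_p⟩ × ⟨x_q⟩),
-- written in normal form (ℤ₂)³-part first, then ℤ_pq-part.
record G (p q : ℕ) : Set where
  constructor ⟨_,_,_,_,_⟩
  field
    a b c : Bool
    i : Fin p
    j : Fin q

module Group (p q : ℕ) {{_ : NonZero p}} {{_ : NonZero q}} where
  open G

  -- e₁ inverts ⟨x_p⟩ and ⟨x_q⟩; e₂, e₃ centralize ⟨x_p⟩ and invert ⟨x_q⟩.
  -- σp(e) = whether e inverts x_p, σq(e) = whether e inverts x_q.
  σp : G p q → Bool
  σp g = a g

  σq : G p q → Bool
  σq g = a g xor b g xor c g

  -- (e x)(e' x') = (e e') (e'⁻¹ x e') x'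
  _·_ : G p q → G p q → G p q
  g · h = ⟨ a g xor a h , b g xor b h , c g xor c h
          , act (σp h) (i g) +ₙ i h
          , act (σq h) (j g) +ₙ j h ⟩

  -- (e x)⁻¹ = e (e⁻¹ x⁻¹ e)
  _⁻¹ : G p q → G p q
  g ⁻¹ = ⟨ a g , b g , c g , act (σp g) (-ₙ i g) , act (σq g) (-ₙ j g) ⟩

  0F : {n : ℕ} {{_ : NonZero n}} → Fin n
  0F {n} = 0 mod n

  1F : {n : ℕ} {{_ : NonZero n}} → Fin n
  1F {n} = 1 mod n

  S : List (G p q)
  S = ⟨ true , false , false , 0F , 1F ⟩
    ∷ ⟨ false , true , false , 0F , 0F ⟩
    ∷ ⟨ false , false , true , 0F , 0F ⟩
    ∷ ⟨ true , true , false , 1F , 0F ⟩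
    ∷ []

  Adj : G p q → G p q → Set
  Adj g h = ∃ λ s → s ∈ S × (h ≡ g · s ⊎ h ≡ g · (s ⁻¹))

  HamiltonianCycle : Set
  HamiltonianCycle =
    Σ (G p q) λ g₀ → Σ (List (G p q)) λ rest →
      Unique (g₀ ∷ rest) × (∀ g → g ∈ (g₀ ∷ rest)) × 3 ≤ length (g₀ ∷ rest)
      × Linked Adj ((g₀ ∷ rest) ++ [ g₀ ])

{-# OPTIONS --safe #-}
-- Write s = e₁e₂x_p and t = e₁x_q.  Their product st = e₂x_p⁻¹x_q squares to x_p⁻², so st
-- has order 2p and the path s(ts)^{2p−1} from a vertex g runs through the 4p elements g(st)ᵏ
-- and g(st)ᵏs of the coset g⟨s,t⟩, ending at gt.  An e₂-edge then enters the next coset;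
-- after q cosets an e₃-edge switches to the other half of G, and after both halves the walk
--   ((s(ts)^{2p−1} e₂)^{q−1} s(ts)^{2p−1} e₃)²
-- is back at its start.  Half, coset, k and side of every vertex can be read back off the
-- group element (k < 2p through ℤ₂ₚ ≅ ℤ₂ × ℤₚ, which needs p odd; that the last coset of a
-- half leads to the first coset of the other needs q odd), so the walk is hamiltonian.
module Submission where

open import Defs
open import Algebra.Bundles using (AbelianGroup; CommutativeRing)
open import Algebra.Structures using (IsAbelianGroup)
import Algebra.Properties.AbelianGroup as AbelianGroupProperties
import Algebra.Properties.CommutativeSemigroup as CommutativeSemigroupProperties
open import Data.Bool using (Bool; true; false; not; _xor_; if_then_else_)
open import Data.Bool.Properties
  using (not-involutive; not-injective; not-¬; not-distribˡ-xor; xor-assoc; xor-comm;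
         xor-same; xor-identityʳ; xor-∧-commutativeRing)
open import Data.Fin using (Fin; toℕ)
open import Data.Fin.Properties using (toℕ-injective; toℕ-fromℕ<; toℕ<n; toℕ≤n)
open import Data.List using (List; []; _∷_; _++_; [_]; concat; applyUpTo; head; length)
open import Data.List.Properties using (++-identityʳ; length-++; length-++-≤ˡ)
open import Data.List.Membership.Propositional using (_∈_)
open import Data.List.Membership.Propositional.Properties
  using (∈-concat⁺′; ∈-concat⁻′; ∈-applyUpTo⁺; ∈-applyUpTo⁻; ∈-++⁺ˡ; ∈-++⁺ʳ)
open import Data.List.Relation.Unary.Any using (here; there)
import Data.List.Relation.Unary.All.Properties as All
import Data.List.Relation.Unary.AllPairs.Properties as AllPairs
open import Data.List.Relation.Unary.AllPairs using ([]; _∷_)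
open import Data.List.Relation.Unary.All using ([]; _∷_)
open import Data.List.Relation.Binary.Disjoint.Propositional using (Disjoint)
open import Data.List.Relation.Unary.Linked using (Linked; []; [-]; _∷_)
open import Data.List.Relation.Unary.Unique.Propositional using (Unique)
import Data.List.Relation.Unary.Unique.Propositional.Properties as Unique
open import Data.Maybe using (just)
open import Data.Nat
  using (ℕ; NonZero; zero; suc; _+_; _∸_; _%_; _<_; _≤_; z≤n; s≤s; _<?_; >-nonZero⁻¹)
open import Data.Nat.Properties
  using (+-comm; +-assoc; +-identityʳ; m∸n+n≡m; ≮⇒≥; <⇒≢; ≤-refl; ≤-trans; ≤-reflexive;
         +-mono-<-≤; +-mono-≤; m<n+o⇒m∸n<o; <-trans; m≤m+n; n≤1+n)
open import Data.Nat.DivMod using (_mod_; m%n<n; %-distribˡ-+; n%n≡0; m<n⇒m%n≡m; [m+n]%n≡m%n)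
open import Data.Nat.Divisibility using (_∣_; divides; ∣-refl; ∣m∣n⇒∣m+n)
open import Data.Nat.Primality using (Prime; composite-≢)
open import Data.Product using (∃; ∃₂; _×_; _,_)
open import Data.Sum using (inj₁)
open import Level using (Level; 0ℓ; _⊔_)
open import Function using (_∘_)
open import Relation.Binary.Core using (Rel)
open import Relation.Binary.PropositionalEquality
  using (_≡_; _≢_; refl; sym; trans; cong; cong₂; subst; isEquivalence; module ≡-Reasoning)
open import Relation.Nullary using (yes; no; contradiction)

module _ {n : ℕ} {{_ : NonZero n}} where

  toℕ-mod : ∀ m → toℕ (m mod n) ≡ m % n
  toℕ-mod m = toℕ-fromℕ< (m%n<n m n)

  %≡%⇒mod≡mod : ∀ {m k} → m % n ≡ k % n → m mod n ≡ k mod n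
  %≡%⇒mod≡mod {m} {k} eq = toℕ-injective (trans (toℕ-mod m) (trans eq (sym (toℕ-mod k))))

  mod-toℕ : ∀ (x : Fin n) → toℕ x mod n ≡ x
  mod-toℕ x = toℕ-injective (trans (toℕ-mod _) (m<n⇒m%n≡m (toℕ<n x)))

  mod-+ : ∀ m k → (m + k) mod n ≡ (m mod n) +ₙ (k mod n)
  mod-+ m k = %≡%⇒mod≡mod (trans (%-distribˡ-+ m k n)
    (cong₂ (λ u v → (u + v) % n) (sym (toℕ-mod m)) (sym (toℕ-mod k))))

  mod-suc : ∀ m → suc m mod n ≡ (m mod n) +ₙ (1 mod n)
  mod-suc m = trans (cong (_mod n) (+-comm 1 m)) (mod-+ m 1)

  +ₙ-comm : ∀ (x y : Fin n) → x +ₙ y ≡ y +ₙ x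
  +ₙ-comm x y = cong (_mod n) (+-comm (toℕ x) (toℕ y))

  +ₙ-assoc : ∀ (x y z : Fin n) → (x +ₙ y) +ₙ z ≡ x +ₙ (y +ₙ z)
  +ₙ-assoc x y z = begin
    (x +ₙ y) +ₙ z                             ≡⟨ cong ((x +ₙ y) +ₙ_) (mod-toℕ z) ⟨
    ((toℕ x + toℕ y) mod n) +ₙ (toℕ z mod n)  ≡⟨ mod-+ (toℕ x + toℕ y) (toℕ z) ⟨
    (toℕ x + toℕ y + toℕ z) mod n             ≡⟨ cong (_mod n) (+-assoc (toℕ x) (toℕ y) (toℕ z)) ⟩
    (toℕ x + (toℕ y + toℕ z)) mod n           ≡⟨ mod-+ (toℕ x) (toℕ y + toℕ z) ⟩
    (toℕ x mod n) +ₙ (y +ₙ z)                 ≡⟨ cong (_+ₙ (y +ₙ z)) (mod-toℕ x) ⟩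
    x +ₙ (y +ₙ z)                             ∎
    where open ≡-Reasoning

  +ₙ-identityˡ : ∀ (x : Fin n) → (0 mod n) +ₙ x ≡ x
  +ₙ-identityˡ x = begin
    (0 mod n) +ₙ x              ≡⟨ cong ((0 mod n) +ₙ_) (mod-toℕ x) ⟨
    (0 mod n) +ₙ (toℕ x mod n)  ≡⟨ mod-+ 0 (toℕ x) ⟨
    toℕ x mod n                 ≡⟨ mod-toℕ x ⟩
    x                           ∎
    where open ≡-Reasoning

  mod-self : n mod n ≡ 0 mod n
  mod-self = %≡%⇒mod≡mod (trans (n%n≡0 n) (sym (m<n⇒m%n≡m (>-nonZero⁻¹ n))))

  -ₙ-inverseˡ : ∀ (x : Fin n) → (-ₙ x) +ₙ x ≡ 0 mod n
  -ₙ-inverseˡ x = begin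
    (-ₙ x) +ₙ x                             ≡⟨ cong ((-ₙ x) +ₙ_) (mod-toℕ x) ⟨
    ((n ∸ toℕ x) mod n) +ₙ (toℕ x mod n)    ≡⟨ mod-+ (n ∸ toℕ x) (toℕ x) ⟨
    (n ∸ toℕ x + toℕ x) mod n               ≡⟨ cong (_mod n) (m∸n+n≡m (toℕ≤n x)) ⟩
    n mod n                                 ≡⟨ mod-self ⟩
    0 mod n                                 ∎
    where open ≡-Reasoning

  +ₙ-isAbelianGroup : IsAbelianGroup _≡_ _+ₙ_ (0 mod n) -ₙ_
  +ₙ-isAbelianGroup = record
    { isGroup = record
      { isMonoid = record
        { isSemigroup = record
          { isMagma = record { isEquivalence = isEquivalence ; ∙-cong = cong₂ _+ₙ_ }
          ; assoc = +ₙ-assoc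
          }
        ; identity = +ₙ-identityˡ , λ x → trans (+ₙ-comm x _) (+ₙ-identityˡ x)
        }
      ; inverse = -ₙ-inverseˡ , λ x → trans (+ₙ-comm x _) (-ₙ-inverseˡ x)
      ; ⁻¹-cong = cong -ₙ_
      }
    ; comm = +ₙ-comm
    }

+ₙ-abelianGroup : (n : ℕ) {{_ : NonZero n}} → AbelianGroup 0ℓ 0ℓ
+ₙ-abelianGroup n = record { isAbelianGroup = +ₙ-isAbelianGroup {n} }

module _ {n : ℕ} {{_ : NonZero n}} where
  open AbelianGroupProperties (+ₙ-abelianGroup n)

  +ₙ-identityʳ : ∀ (x : Fin n) → x +ₙ (0 mod n) ≡ x
  +ₙ-identityʳ = AbelianGroup.identityʳ (+ₙ-abelianGroup n)

  -ₙ-involutive : ∀ (x : Fin n) → -ₙ (-ₙ x) ≡ x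
  -ₙ-involutive = ⁻¹-involutive

  -ₙ0 : -ₙ (0 mod n) ≡ 0 mod n
  -ₙ0 = ε⁻¹≈ε

  reflect : Bool → Fin n → Fin n
  reflect false y = y
  reflect true  y = (1 mod n) +ₙ (-ₙ y)

  reflect-step : ∀ t y → (-ₙ reflect t y) +ₙ (1 mod n) ≡ reflect (not t) y
  reflect-step false y = +ₙ-comm (-ₙ y) (1 mod n)
  reflect-step true  y =
    trans (cong (_+ₙ (1 mod n)) (⁻¹-anti-homo‿- (1 mod n) y)) (//-rightDividesˡ (1 mod n) y)

  reflect-involutive : ∀ t y → reflect t (reflect t y) ≡ y
  reflect-involutive false y = refl
  reflect-involutive true  y = trans (+ₙ-comm (1 mod n) _) (reflect-step true y)

  -ₙ≡reflect-suc : ∀ y → -ₙ y ≡ reflect true (y +ₙ (1 mod n))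
  -ₙ≡reflect-suc y = trans (cong -ₙ_ (sym (//-rightDividesʳ (1 mod n) y)))
                          (⁻¹-anti-homo‿- (y +ₙ (1 mod n)) (1 mod n))

  negOrSuc : Bool → Fin n → Fin n
  negOrSuc false r = -ₙ r
  negOrSuc true  r = r +ₙ (1 mod n)

  negOrPred : Bool → Fin n → Fin n
  negOrPred false i = -ₙ i
  negOrPred true  i = i +ₙ (-ₙ (1 mod n))

  negOrPred-negOrSuc : ∀ f r → negOrPred f (negOrSuc f r) ≡ r
  negOrPred-negOrSuc false r = ⁻¹-involutive r
  negOrPred-negOrSuc true  r = //-rightDividesʳ (1 mod n) r

  negOrSuc-negOrPred : ∀ f i → negOrSuc f (negOrPred f i) ≡ i
  negOrSuc-negOrPred false i = ⁻¹-involutive i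
  negOrSuc-negOrPred true  i = //-rightDividesˡ (1 mod n) i

xor-cancelˡ : ∀ x y → x xor (x xor y) ≡ y
xor-cancelˡ x y = trans (sym (xor-assoc x x y)) (cong (_xor y) (xor-same x))

xor-cancelʳ : ∀ x y → (x xor y) xor y ≡ x
xor-cancelʳ x y = trans (xor-assoc x y y) (trans (cong (x xor_) (xor-same y)) (xor-identityʳ x))

odd : ℕ → Bool
odd zero    = false
odd (suc n) = not (odd n)

odd-+ : ∀ m n → odd (m + n) ≡ odd m xor odd n
odd-+ zero    n = refl
odd-+ (suc m) n = trans (cong not (odd-+ m n)) (not-distribˡ-xor (odd m) (odd n))

odd[n+n] : ∀ n → odd (n + n) ≡ false
odd[n+n] n = trans (odd-+ n n) (xor-same (odd n))

even⇒2∣ : ∀ n → odd n ≡ false → 2 ∣ n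
even⇒2∣ zero          _  = divides 0 refl
even⇒2∣ (suc (suc n)) eq = ∣m∣n⇒∣m+n ∣-refl (even⇒2∣ n (trans (sym (not-involutive (odd n))) eq))

prime⇒odd : ∀ {n} {{_ : NonZero n}} → Prime n → 2 < n → odd n ≡ true
prime⇒odd {n} pr 2<n with odd n in eq
... | true  = refl
... | false = contradiction (composite-≢ 2 (<⇒≢ 2<n) (even⇒2∣ n eq)) (Prime.notComposite pr)

-- ℤ₂ₚ ≅ ℤ₂ × ℤₚ for odd p

crt : ∀ {p} → Fin p → Bool → ℕ
crt {p} r κ = toℕ r + (if odd (toℕ r) xor κ then p else 0)

module _ {p : ℕ} {{_ : NonZero p}} where

  crt-mod : ∀ r κ → crt r κ mod p ≡ r
  crt-mod r κ with odd (toℕ r) xor κ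
  ... | true  = trans (%≡%⇒mod≡mod ([m+n]%n≡m%n (toℕ r) p)) (mod-toℕ r)
  ... | false = trans (cong (_mod p) (+-identityʳ (toℕ r))) (mod-toℕ r)

  crt-< : ∀ r κ → crt r κ < p + p
  crt-< r κ with odd (toℕ r) xor κ
  ... | true  = +-mono-<-≤ (toℕ<n r) (≤-refl {p})
  ... | false = +-mono-<-≤ (toℕ<n r) (z≤n {p})

  module _ (p-odd : odd p ≡ true) where

    odd-+-p : ∀ m b → odd (m + (if b then p else 0)) ≡ odd m xor b
    odd-+-p m true  = trans (odd-+ m p) (cong (odd m xor_) p-odd)
    odd-+-p m false = trans (cong odd (+-identityʳ m)) (sym (xor-identityʳ (odd m)))

    crt-odd : ∀ r κ → odd (crt r κ) ≡ κ
    crt-odd r κ = trans (odd-+-p (toℕ r) _) (xor-cancelˡ (odd (toℕ r)) κ)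

    crt-+p : ∀ r → r < p → crt ((r + p) mod p) (odd (r + p)) ≡ r + p
    crt-+p r r<p
      rewrite trans (toℕ-mod (r + p)) (trans ([m+n]%n≡m%n r p) (m<n⇒m%n≡m r<p))
            | odd-+ r p | p-odd | xor-cancelˡ (odd r) true = refl

    crt-mod-odd : ∀ k → k < p + p → crt (k mod p) (odd k) ≡ k
    crt-mod-odd k k<2p with k <? p
    ... | yes k<p rewrite trans (toℕ-mod k) (m<n⇒m%n≡m k<p) | xor-same (odd k) = +-identityʳ k
    ... | no k≮p = subst (λ m → crt (m mod p) (odd m) ≡ m) (m∸n+n≡m (≮⇒≥ k≮p))
                     (crt-+p (k ∸ p) (m<n+o⇒m∸n<o k p k<2p))

head-++ : ∀ {a} {A : Set a} {xs ys : List A} {x} → head xs ≡ just x → head (xs ++ ys) ≡ just x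
head-++ {xs = _ ∷ _} refl = refl

module _ {a ℓ : Level} {A : Set a} where

  LinkedTo : Rel A ℓ → List A → A → Set (a ⊔ ℓ)
  LinkedTo R xs z = Linked R (xs ++ [ z ])

  ++-linkedTo : ∀ {R : Rel A ℓ} xs {ys y z} →
                LinkedTo R xs y → head ys ≡ just y → LinkedTo R ys z → LinkedTo R (xs ++ ys) z
  ++-linkedTo []                      _            _    Rys = Rys
  ++-linkedTo (x ∷ [])     {_ ∷ _}    (Rxy ∷ [-])  refl Rys = Rxy ∷ Rys
  ++-linkedTo (x ∷ x′ ∷ xs)           (Rxx′ ∷ Rxs) eq   Rys =
    Rxx′ ∷ ++-linkedTo (x′ ∷ xs) Rxs eq Rys

  concat-applyUpTo-linkedTo :
    ∀ {R : Rel A ℓ} (F : ℕ → List A) (h : ℕ → A) n {z} →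
    (∀ k → head (F k) ≡ just (h k)) →
    (∀ {k} → suc k < n → LinkedTo R (F k) (h (suc k))) →
    (∀ {k} → suc k ≡ n → LinkedTo R (F k) z) →
    LinkedTo R (concat (applyUpTo F n)) z
  concat-applyUpTo-linkedTo F h zero          hd link last = [-]
  concat-applyUpTo-linkedTo F h (suc zero)    hd link last =
    subst (λ xs → LinkedTo _ xs _) (sym (++-identityʳ (F 0))) (last refl)
  concat-applyUpTo-linkedTo F h (suc (suc n)) hd link last =
    ++-linkedTo (F 0) (link (s≤s (s≤s z≤n))) (head-++ (hd 1))
      (concat-applyUpTo-linkedTo (F ∘ suc) (h ∘ suc) (suc n)
        (hd ∘ suc) (link ∘ s≤s) (last ∘ cong suc))

module _ {a : Level} {A : Set a} (F : ℕ → List A) where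

  ∈-concat-applyUpTo⁺ : ∀ {n k y} → k < n → y ∈ F k → y ∈ concat (applyUpTo F n)
  ∈-concat-applyUpTo⁺ k<n y∈Fk = ∈-concat⁺′ y∈Fk (∈-applyUpTo⁺ F k<n)

  ∈-concat-applyUpTo⁻ : ∀ n {y} → y ∈ concat (applyUpTo F n) → ∃ λ k → k < n × y ∈ F k
  ∈-concat-applyUpTo⁻ n y∈
    with xs , y∈xs , xs∈ ← ∈-concat⁻′ (applyUpTo F n) y∈
    with k , k<n , refl ← ∈-applyUpTo⁻ F xs∈ = k , k<n , y∈xs

  head-concat-applyUpTo : ∀ {n x} → 0 < n → head (F 0) ≡ just x →
                          head (concat (applyUpTo F n)) ≡ just x
  head-concat-applyUpTo {suc n} _ = head-++

  length-concat-applyUpTo : ∀ {n} → 0 < n → length (F 0) ≤ length (concat (applyUpTo F n))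
  length-concat-applyUpTo {suc n} _ = length-++-≤ˡ (F 0)

  concat-applyUpTo-unique : ∀ n (tag : A → ℕ) →
    (∀ {k} → k < n → Unique (F k)) → (∀ {k y} → k < n → y ∈ F k → tag y ≡ k) →
    Unique (concat (applyUpTo F n))
  concat-applyUpTo-unique n tag unique tagged = Unique.concat⁺ (All.applyUpTo⁺₁ F n unique)
    (AllPairs.applyUpTo⁺₁ F n λ i<j j<n (y∈Fi , y∈Fj) →
      <⇒≢ i<j (trans (sym (tagged (<-trans i<j j<n) y∈Fi)) (tagged j<n y∈Fj)))

module Cycle (p q : ℕ) {{_ : NonZero p}} {{_ : NonZero q}}
             (p-odd : odd p ≡ true) (q-odd : odd q ≡ true) where
  open Group p q
  open CommutativeSemigroupProperties (CommutativeRing.+-commutativeSemigroup xor-∧-commutativeRing)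
    using () renaming (interchange to xor-interchange)

  -- Coordinates (a, σq, c) rather than (a, b, c): σq is additive (σq-·), so right
  -- multiplication by a generator acts coordinatewise (mkG-·).
  mkG : Bool → Bool → Bool → Fin p → Fin q → G p q
  mkG a σ c i j = ⟨ a , (a xor σ) xor c , c , i , j ⟩

  mkG-cong : ∀ {a a′ σ σ′ c c′ i i′ j j′} → a ≡ a′ → σ ≡ σ′ → c ≡ c′ → i ≡ i′ → j ≡ j′ →
             mkG a σ c i j ≡ mkG a′ σ′ c′ i′ j′
  mkG-cong refl refl refl refl refl = refl

  σq-mkG : ∀ a σ c i j → σq (mkG a σ c i j) ≡ σ
  σq-mkG a σ c i j = trans (cong (a xor_) (xor-cancelʳ (a xor σ) c)) (xor-cancelˡ a σ)

  mkG-σq : ∀ g → mkG (G.a g) (σq g) (G.c g) (G.i g) (G.j g) ≡ g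
  mkG-σq ⟨ a , b , c , i , j ⟩ =
    cong (λ b′ → ⟨ a , b′ , c , i , j ⟩)
      (trans (cong (_xor c) (xor-cancelˡ a (b xor c))) (xor-cancelʳ b c))

  σq-· : ∀ g h → σq (g · h) ≡ σq g xor σq h
  σq-· ⟨ a , b , c , _ , _ ⟩ ⟨ a′ , b′ , c′ , _ , _ ⟩ =
    trans (cong ((a xor a′) xor_) (xor-interchange b b′ c c′))
          (xor-interchange a a′ (b xor c) (b′ xor c′))

  mkG-· : ∀ a σ c i j s → mkG a σ c i j · s ≡
          mkG (a xor G.a s) (σ xor σq s) (c xor G.c s)
              (act (σp s) i +ₙ G.i s) (act (σq s) j +ₙ G.j s)
  mkG-· a σ c i j s = trans (sym (mkG-σq (mkG a σ c i j · s)))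
    (cong (λ τ → mkG _ τ _ _ _)
          (trans (σq-· (mkG a σ c i j) s) (cong (_xor σq s) (σq-mkG a σ c i j))))

  e₁xq e₂ e₃ e₁e₂xp : G p q
  e₁xq   = ⟨ true  , false , false , 0F , 1F ⟩
  e₂     = ⟨ false , true  , false , 0F , 0F ⟩
  e₃     = ⟨ false , false , true  , 0F , 0F ⟩
  e₁e₂xp = ⟨ true  , true  , false , 1F , 0F ⟩

  adjacent : ∀ g {h s} → s ∈ S → g · s ≡ h → Adj g h
  adjacent g s∈S eq = _ , s∈S , inj₁ (sym eq)

  -- vertex c L k f = g (st)ᵏ sᶠ, where g = vertex c L 0 false starts the L-th coset of half c.
  vertex : Bool → ℕ → ℕ → Bool → G p q
  vertex c L k f =
    mkG (f xor (odd L xor c)) (not (odd k)) c (negOrSuc f (k mod p)) (reflect (not (odd k)) (L mod q))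

  vertex-· : ∀ c L k f s → vertex c L k f · s ≡
             mkG ((f xor (odd L xor c)) xor G.a s) (not (odd k) xor σq s) (c xor G.c s)
                 (act (σp s) (negOrSuc f (k mod p)) +ₙ G.i s)
                 (act (σq s) (reflect (not (odd k)) (L mod q)) +ₙ G.j s)
  vertex-· c L k f =
    mkG-· (f xor (odd L xor c)) (not (odd k)) c (negOrSuc f (k mod p)) (reflect (not (odd k)) (L mod q))

  e₁e₂xp-edge : ∀ c L k → Adj (vertex c L k false) (vertex c L k true)
  e₁e₂xp-edge c L k = adjacent (vertex c L k false) (there (there (there (here refl))))
    (trans (vertex-· c L k false e₁e₂xp)
           (mkG-cong (xor-comm _ true) (xor-identityʳ _) (xor-identityʳ c)
                     (cong (_+ₙ 1F) (-ₙ-involutive _)) (+ₙ-identityʳ _)))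

  e₁xq-edge : ∀ c L k → Adj (vertex c L k true) (vertex c L (suc k) false)
  e₁xq-edge c L k = adjacent (vertex c L k true) (here refl)
    (trans (vertex-· c L k true e₁xq)
           (mkG-cong (trans (xor-comm _ true) (not-involutive _)) (xor-comm _ true) (xor-identityʳ c)
                     (trans (+ₙ-identityʳ _) (cong -ₙ_ (sym (mod-suc k))))
                     (reflect-step (not (odd k)) _)))

  vertex-blockEnd : ∀ c L k → suc k ≡ p + p →
                    vertex c L k true ≡ mkG (not (odd L xor c)) false c 0F (L mod q)
  vertex-blockEnd c L k eq = mkG-cong refl σ≡false refl
      (trans (sym (mod-suc k))
        (trans (cong (_mod p) eq) (trans (%≡%⇒mod≡mod ([m+n]%n≡m%n p p)) mod-self)))
      (cong (λ σ → reflect σ (L mod q)) σ≡false)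
    where
    σ≡false : not (odd k) ≡ false
    σ≡false = trans (cong odd eq) (odd[n+n] p)

  -ₙ≡reflect-mod-suc : ∀ L → -ₙ (L mod q) ≡ reflect true (suc L mod q)
  -ₙ≡reflect-mod-suc L = trans (-ₙ≡reflect-suc _) (cong (reflect true) (sym (mod-suc L)))

  e₂-edge : ∀ {c L k} → suc k ≡ p + p → Adj (vertex c L k true) (vertex c (suc L) 0 false)
  e₂-edge {c} {L} {k} eq = adjacent (vertex c L k true) (there (here refl)) (begin
    vertex c L k true · e₂
      ≡⟨ cong (_· e₂) (vertex-blockEnd c L k eq) ⟩
    mkG (not (odd L xor c)) false c 0F (L mod q) · e₂
      ≡⟨ mkG-· (not (odd L xor c)) false c 0F (L mod q) e₂ ⟩
    mkG (not (odd L xor c) xor false) true (c xor false) (0F +ₙ 0F) ((-ₙ (L mod q)) +ₙ 0F)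
      ≡⟨ mkG-cong (trans (xor-identityʳ _) (not-distribˡ-xor (odd L) c)) refl (xor-identityʳ c)
                  (trans (+ₙ-identityʳ _) (sym -ₙ0))
                  (trans (+ₙ-identityʳ _) (-ₙ≡reflect-mod-suc L)) ⟩
    vertex c (suc L) 0 false
      ∎)
    where open ≡-Reasoning

  e₃-edge : ∀ {c L k} → suc L ≡ q → suc k ≡ p + p →
            Adj (vertex c L k true) (vertex (not c) 0 0 false)
  e₃-edge {c} {L} {k} eqL eqk = adjacent (vertex c L k true) (there (there (here refl))) (begin
    vertex c L k true · e₃
      ≡⟨ cong (_· e₃) (vertex-blockEnd c L k eqk) ⟩
    mkG (not (odd L xor c)) false c 0F (L mod q) · e₃
      ≡⟨ mkG-· (not (odd L xor c)) false c 0F (L mod q) e₃ ⟩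
    mkG (not (odd L xor c) xor false) true (c xor true) (0F +ₙ 0F) ((-ₙ (L mod q)) +ₙ 0F)
      ≡⟨ mkG-cong (trans (xor-identityʳ _) (cong (λ ℓ → not (ℓ xor c)) L-even)) refl
                  (xor-comm c true) (trans (+ₙ-identityʳ _) (sym -ₙ0))
                  (trans (+ₙ-identityʳ _) (trans (-ₙ≡reflect-mod-suc L)
                    (cong (reflect true) (trans (cong (_mod q) eqL) mod-self)))) ⟩
    vertex (not c) 0 0 false
      ∎)
    where
    open ≡-Reasoning
    L-even : odd L ≡ false
    L-even = not-injective (trans (cong odd eqL) q-odd)

  σq-vertex : ∀ c L k f → σq (vertex c L k f) ≡ not (odd k)
  σq-vertex c L k f =
    σq-mkG (f xor (odd L xor c)) (not (odd k)) c (negOrSuc f (k mod p)) (reflect (not (odd k)) (L mod q))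

  blockIndex : G p q → ℕ
  blockIndex g = toℕ (reflect (σq g) (G.j g))

  pairSide : G p q → Bool
  pairSide g = G.a g xor (odd (blockIndex g) xor G.c g)

  pairIndex : G p q → ℕ
  pairIndex g = crt (negOrPred (pairSide g) (G.i g)) (not (σq g))

  module _ {c : Bool} {L k : ℕ} {f : Bool} (L<q : L < q) where

    blockIndex-vertex : blockIndex (vertex c L k f) ≡ L
    blockIndex-vertex = begin
      toℕ (reflect (σq (vertex c L k f)) (reflect (not (odd k)) (L mod q)))
        ≡⟨ cong (λ σ → toℕ (reflect σ _)) (σq-vertex c L k f) ⟩
      toℕ (reflect (not (odd k)) (reflect (not (odd k)) (L mod q)))
        ≡⟨ cong toℕ (reflect-involutive (not (odd k)) (L mod q)) ⟩
      toℕ (L mod q)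
        ≡⟨ trans (toℕ-mod L) (m<n⇒m%n≡m L<q) ⟩
      L ∎
      where open ≡-Reasoning

    pairSide-vertex : pairSide (vertex c L k f) ≡ f
    pairSide-vertex =
      trans (cong (λ m → (f xor (odd L xor c)) xor (odd m xor c)) blockIndex-vertex)
            (xor-cancelʳ f (odd L xor c))

    pairIndex-vertex : k < p + p → pairIndex (vertex c L k f) ≡ k
    pairIndex-vertex k<2p = trans
      (cong₂ crt (trans (cong (λ f′ → negOrPred f′ _) pairSide-vertex) (negOrPred-negOrSuc f _))
                 (trans (cong not (σq-vertex c L k f)) (not-involutive (odd k))))
      (crt-mod-odd p-odd k k<2p)

  vertex-indices : ∀ g → vertex (G.c g) (blockIndex g) (pairIndex g) (pairSide g) ≡ g
  vertex-indices g = trans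
    (mkG-cong (xor-cancelʳ (G.a g) (odd (blockIndex g) xor G.c g)) σ-eq refl
      (trans (cong (negOrSuc f) (crt-mod r (not (σq g)))) (negOrSuc-negOrPred f (G.i g)))
      (trans (cong₂ reflect σ-eq (mod-toℕ _)) (reflect-involutive (σq g) (G.j g))))
    (mkG-σq g)
    where
    f = pairSide g
    r = negOrPred f (G.i g)
    σ-eq : not (odd (pairIndex g)) ≡ σq g
    σ-eq = trans (cong not (crt-odd p-odd r (not (σq g)))) (not-involutive (σq g))

  pair : Bool → ℕ → ℕ → List (G p q)
  pair c L k = vertex c L k false ∷ vertex c L k true ∷ []

  block : Bool → ℕ → List (G p q)
  block c L = concat (applyUpTo (pair c L) (p + p))

  half : Bool → List (G p q)
  half c = concat (applyUpTo (block c) q)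

  cycle : List (G p q)
  cycle = half false ++ half true

  0<2p : 0 < p + p
  0<2p = ≤-trans (>-nonZero⁻¹ p) (m≤m+n p p)

  ∈-pair⁺ : ∀ {c L k} f → vertex c L k f ∈ pair c L k
  ∈-pair⁺ false = here refl
  ∈-pair⁺ true  = there (here refl)

  ∈-pair⁻ : ∀ {c L k y} → y ∈ pair c L k → ∃ λ f → y ≡ vertex c L k f
  ∈-pair⁻ (here eq)         = false , eq
  ∈-pair⁻ (there (here eq)) = true , eq

  ∈-block⁻ : ∀ {c L y} → y ∈ block c L → ∃₂ λ k f → k < p + p × y ≡ vertex c L k f
  ∈-block⁻ {c} {L} y∈
    with k , k<2p , y∈pair ← ∈-concat-applyUpTo⁻ (pair c L) (p + p) y∈
    with f , eq ← ∈-pair⁻ y∈pair = k , f , k<2p , eq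

  ∈-half⇒c : ∀ {c y} → y ∈ half c → G.c y ≡ c
  ∈-half⇒c {c} y∈
    with L , _ , y∈block ← ∈-concat-applyUpTo⁻ (block c) q y∈
    with _ , _ , _ , refl ← ∈-block⁻ y∈block = refl

  pair-unique : ∀ c L k → Unique (pair c L k)
  pair-unique c L k = ((not-¬ refl ∘ cong G.a) ∷ []) ∷ [] ∷ []

  block-unique : ∀ {c L} → L < q → Unique (block c L)
  block-unique {c} {L} L<q =
    concat-applyUpTo-unique (pair c L) (p + p) pairIndex (λ _ → pair-unique c L _) tagged
    where
    tagged : ∀ {k y} → k < p + p → y ∈ pair c L k → pairIndex y ≡ k
    tagged {k} k<2p y∈ with f , refl ← ∈-pair⁻ y∈ = pairIndex-vertex {c} {L} {k} {f} L<q k<2p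

  half-unique : ∀ c → Unique (half c)
  half-unique c = concat-applyUpTo-unique (block c) q blockIndex block-unique tagged
    where
    tagged : ∀ {L y} → L < q → y ∈ block c L → blockIndex y ≡ L
    tagged {L} L<q y∈ with k , f , _ , refl ← ∈-block⁻ y∈ = blockIndex-vertex {c} {L} {k} {f} L<q

  cycle-unique : Unique cycle
  cycle-unique = Unique.++⁺ (half-unique false) (half-unique true) disjoint
    where
    disjoint : Disjoint (half false) (half true)
    disjoint (y∈₁ , y∈₂) = contradiction (trans (sym (∈-half⇒c y∈₁)) (∈-half⇒c y∈₂)) λ ()

  ∈-half : ∀ g → g ∈ half (G.c g)
  ∈-half g = subst (_∈ half (G.c g)) (vertex-indices g)
    (∈-concat-applyUpTo⁺ (block (G.c g)) (toℕ<n _)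
      (∈-concat-applyUpTo⁺ (pair (G.c g) (blockIndex g))
        (crt-< (negOrPred (pairSide g) (G.i g)) (not (σq g))) (∈-pair⁺ (pairSide g))))

  ∈-cycle : ∀ g → g ∈ cycle
  ∈-cycle g with G.c g | ∈-half g
  ... | false | g∈ = ∈-++⁺ˡ g∈
  ... | true  | g∈ = ∈-++⁺ʳ (half false) g∈

  head-block : ∀ c L → head (block c L) ≡ just (vertex c L 0 false)
  head-block c L = head-concat-applyUpTo (pair c L) 0<2p refl

  head-half : ∀ c → head (half c) ≡ just (vertex c 0 0 false)
  head-half c = head-concat-applyUpTo (block c) (>-nonZero⁻¹ q) (head-block c 0)

  block-linkedTo : ∀ {c L z} → (∀ {k} → suc k ≡ p + p → Adj (vertex c L k true) z) →
                   LinkedTo Adj (block c L) z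
  block-linkedTo {c} {L} last =
    concat-applyUpTo-linkedTo (pair c L) (λ k → vertex c L k false) (p + p) (λ _ → refl)
    (λ {k} _  → e₁e₂xp-edge c L k ∷ e₁xq-edge c L k ∷ [-])
    (λ {k} eq → e₁e₂xp-edge c L k ∷ last eq ∷ [-])

  half-linkedTo : ∀ {c z} → (∀ {L k} → suc L ≡ q → suc k ≡ p + p → Adj (vertex c L k true) z) →
                  LinkedTo Adj (half c) z
  half-linkedTo {c} last = concat-applyUpTo-linkedTo (block c) (λ L → vertex c L 0 false) q
    (head-block c) (λ _ → block-linkedTo e₂-edge) (λ eq → block-linkedTo (last eq))

  cycle-linkedTo : LinkedTo Adj cycle (vertex false 0 0 false)
  cycle-linkedTo =
    ++-linkedTo (half false) (half-linkedTo e₃-edge) (head-half true) (half-linkedTo e₃-edge)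

  2≤length-half : ∀ c → 2 ≤ length (half c)
  2≤length-half c = ≤-trans (length-concat-applyUpTo (pair c 0) 0<2p)
                            (length-concat-applyUpTo (block c) (>-nonZero⁻¹ q))

  3≤length-cycle : 3 ≤ length cycle
  3≤length-cycle = ≤-trans (n≤1+n 3)
    (≤-trans (+-mono-≤ (2≤length-half false) (2≤length-half true))
             (≤-reflexive (sym (length-++ (half false)))))

  hamiltonianCycle-fromList : ∀ {g₀} xs → head xs ≡ just g₀ → Unique xs → (∀ g → g ∈ xs) →
                              3 ≤ length xs → LinkedTo Adj xs g₀ → HamiltonianCycle
  hamiltonianCycle-fromList (g₀ ∷ rest) refl unique complete long linked =
    g₀ , rest , unique , complete , long , linked

  hamiltonianCycle : HamiltonianCycle
  hamiltonianCycle = hamiltonianCycle-fromList cycle (head-++ (head-half false))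
    cycle-unique ∈-cycle 3≤length-cycle cycle-linkedTo

lemma5p2 : (p q : ℕ) {{_ : NonZero p}} {{_ : NonZero q}} →
    Prime p → Prime q → 5 < p → 5 < q → p ≢ q →
    Group.HamiltonianCycle p q
lemma5p2 p q p-prime q-prime 5<p 5<q _ =
  Cycle.hamiltonianCycle p q (prime⇒odd p-prime (<-trans 2<5 5<p))
                             (prime⇒odd q-prime (<-trans 2<5 5<q))
  where
  2<5 : 2 < 5
  2<5 = s≤s (s≤s (s≤s z≤n))
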